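{- There exists an absolute constant $C>0$ such that for every integer $n\ge 1$, the number $P_n$ of labeled PCGs on vertex set $\{1,\dots,n\}$ satisfies $P_n\le e^{Cn\log n}$.
   Context: All graphs are finite, simple and undirected. For an edge-weighted tree $T$ (nonnegative real edge weights) and leaves $x,y$, $d_T(x,y)$ is the sum of the weights on the unique $x$–$y$ path; $L(T)$ is the leaf set. A graph $G=(V,E)$ is a PCG if there exist an edge-weighted tree $T$, reals $0\le d_{\min}\le d_{\max}$ and a bijection $\zeta:V\to L(T)$ such that for all distinct $u,v\in V$: $uv\in E \iff d_{\min}\le d_T(\zeta(u),\zeta(v))\le d_{\max}$. A labeled PCG on $\{1,\dots,n\}$ is a graph with vertex set $\{1,\dots,n\}$ (distinguished by its edge set) that is a PCG.
   Formalization: The edge weights of the tree and the thresholds $d_{\min}$ and $d_{\max}$ are taken in the rationals rather than the reals. -}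

module Defs where

open import Data.Nat using (ℕ; zero; suc; _+_; _≤_)
open import Data.Fin using (Fin; zero; suc; _≟_)
open import Data.Bool using (Bool; true; false)
open import Data.Rational using (ℚ; 0ℚ) renaming (_+_ to _+ℚ_; _≤_ to _≤ℚ_)
open import Data.List using (List; length)
open import Data.List.Relation.Unary.Any using (Any)
open import Data.Product using (Σ; ∃; _×_)
open import Relation.Nullary using (¬_; yes; no)
open import Relation.Binary.PropositionalEquality using (_≡_)
open import Function.Bundles using (_⇔_)
open import Function.Definitions using (Injective)

-- Simple graphs on vertex set Fin n (labels 0..n-1 stand for 1..n).
record Graph (n : ℕ) : Set where
  field
    adj   : Fin n → Fin n → Bool
    sym   : ∀ u v → adj u v ≡ adj v u
    irrefl : ∀ u → adj u u ≡ false
open Graph public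

-- Every finite tree arises by starting from a single vertex
-- and repeatedly attaching a new vertex (index zero, old vertices shifted
-- by suc) by an edge of weight w ≥ 0 to an existing vertex p.
data WTree : ℕ → Set where
  single : WTree 1
  attach : ∀ {m} → WTree m → (p : Fin m) → (w : ℚ) → 0ℚ ≤ℚ w → WTree (suc m)

dist : ∀ {m} → WTree m → Fin m → Fin m → ℚ
dist single zero zero = 0ℚ
dist (attach t p w _) zero zero = 0ℚ
dist (attach t p w _) zero (suc j) = w +ℚ dist t p j
dist (attach t p w _) (suc i) zero = w +ℚ dist t p i
dist (attach t p w _) (suc i) (suc j) = dist t i j

deg : ∀ {m} → WTree m → Fin m → ℕ
deg single zero = 0
deg (attach t p w _) zero = 1
deg (attach t p w _) (suc i) with i ≟ p
... | yes _ = suc (deg t i)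
... | no _  = deg t i

-- leaves: vertices of degree ≤ 1 (degree exactly 1 in every tree with
-- ≥ 2 vertices; the one-vertex tree has its vertex as its unique leaf)
IsLeaf : ∀ {m} → WTree m → Fin m → Set
IsLeaf t x = deg t x ≤ 1

IsPCG : ∀ {n} → Graph n → Set
IsPCG {n} G =
  Σ ℕ λ m → Σ (WTree m) λ T → Σ ℚ λ dmin → Σ ℚ λ dmax →
  Σ (Fin n → Fin m) λ ζ →
    (0ℚ ≤ℚ dmin) × (dmin ≤ℚ dmax) ×
    Injective _≡_ _≡_ ζ ×
    (∀ v → IsLeaf T (ζ v)) ×
    (∀ x → IsLeaf T x → ∃ λ v → ζ v ≡ x) ×
    (∀ u v → ¬ (u ≡ v) →
      ((adj G u v ≡ true) ⇔ ((dmin ≤ℚ dist T (ζ u) (ζ v)) × (dist T (ζ u) (ζ v) ≤ℚ dmax))))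

SameGraph : ∀ {n} → Graph n → Graph n → Set
SameGraph G H = ∀ u v → adj G u v ≡ adj H u v

-- "the number of labeled PCGs on Fin n is at most N": some list of at most
-- N graphs contains (a copy of) every labeled PCG on Fin n.
NumPCG≤ : ℕ → ℕ → Set
NumPCG≤ n N =
  Σ (List (Graph n)) λ Gs → (length Gs ≤ N) ×
    (∀ (G : Graph n) → IsPCG G → Any (SameGraph G) Gs)

{-# OPTIONS --safe #-}
module Submission where

-- Let a PCG on n ≥ 2 vertices be realised by leaf distances D i j in a tree and a window [L, U]. Seen from
-- leaf 0, the four-point condition makes the (doubled) Gromov products ⟨i∣j⟩ = D 0 i + D 0 j - D i j
-- ultrametric, so ⟨i∣j⟩ = min (⟨i∣a⟩, ⟨a∣j⟩) when a maximises ⟨·∣j⟩ among indices below j. Hence every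
-- ⟨i∣j⟩ is one of the 2n values ⟨i∣i⟩ and ⟨parent j∣j⟩, and which one is read off a "shape": the parent
-- map together with the ranks of these 2n values; there are n^O(n) shapes. For a fixed shape, every edge
-- test L ≤ D i j ≤ U is a sign condition on an affine form in 2n + 2 variables (the thresholds, the
-- heights D 0 i and the products ⟨parent j∣j⟩), once L and U are moved so that no distance lies on them.
-- So the graph is determined by the shape and by an open cell of an arrangement of 2n² hyperplanes, and
-- N hyperplanes cut ℚ^K into at most (2N + 1)^K open cells: adding a hyperplane only splits the cells it
-- meets, and these correspond to the cells of the arrangement restricted to it.

module Enumeration where

  open import Data.Fin using (Fin; zero; suc)
  open import Data.List using (List; []; _∷_; map; filter; length; allFin; concatMap; cartesianProduct)
  open import Data.List.Properties using (length-++; length-map; length-tabulate)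
  open import Data.List.Membership.Propositional using (_∈_; lose)
  open import Data.List.Membership.Propositional.Properties using (∈-allFin; ∈-cartesianProduct⁺)
  open import Data.List.Relation.Unary.Any as Any using (Any; here; there)
  open import Data.List.Relation.Unary.Any.Properties using (map⁺; concatMap⁺)
  open import Data.Nat using (zero; suc; _+_; _*_; _^_; _≤_; _<_; z≤n; s≤s)
  open import Data.Nat.Properties using (≤-refl; ≤-trans; ≤-reflexive; +-mono-≤; *-monoʳ-≤; m≤n⇒m≤1+n; m<n⇒m<1+n)
  open import Data.Product using (_×_; _,_)
  import Data.Vec.Functional as Vector
  open import Function using (_∘_)
  open import Relation.Binary.PropositionalEquality using (_≡_; _≗_; refl; trans; cong₂)
  open import Relation.Nullary using (¬_; yes; no; contradiction)
  open import Relation.Unary using (Decidable)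

  length-concatMap-≤ : ∀ {A B : Set} (f : A → List B) {m} → (∀ x → length (f x) ≤ m) →
                       ∀ xs → length (concatMap f xs) ≤ length xs * m
  length-concatMap-≤ f bound [] = z≤n
  length-concatMap-≤ f bound (x ∷ xs) =
    ≤-trans (≤-reflexive (length-++ (f x))) (+-mono-≤ (bound x) (length-concatMap-≤ f bound xs))

  length-cartesianProduct : ∀ {A B : Set} (xs : List A) (ys : List B) →
                            length (cartesianProduct xs ys) ≡ length xs * length ys
  length-cartesianProduct [] ys = refl
  length-cartesianProduct (x ∷ xs) ys =
    trans (length-++ (map (x ,_) ys)) (cong₂ _+_ (length-map (x ,_) ys) (length-cartesianProduct xs ys))

  module _ {A : Set} {P Q : A → Set} (P? : Decidable P) (Q? : Decidable Q) (P⇒Q : ∀ {x} → P x → Q x) where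

    length-filter-mono : ∀ xs → length (filter P? xs) ≤ length (filter Q? xs)
    length-filter-mono [] = z≤n
    length-filter-mono (x ∷ xs) with P? x | Q? x
    ... | yes _ | yes _ = s≤s (length-filter-mono xs)
    ... | yes px | no ¬qx = contradiction (P⇒Q px) ¬qx
    ... | no _ | yes _ = m≤n⇒m≤1+n (length-filter-mono xs)
    ... | no _ | no _ = length-filter-mono xs

    length-filter-< : ∀ {x xs} → x ∈ xs → ¬ P x → Q x → length (filter P? xs) < length (filter Q? xs)
    length-filter-< {xs = y ∷ ys} (here refl) ¬py qy with P? y | Q? y
    ... | yes py | _ = contradiction py ¬py
    ... | no _ | yes _ = s≤s (length-filter-mono ys)
    ... | no _ | no ¬qy = contradiction qy ¬qy
    length-filter-< {xs = y ∷ ys} (there x∈ys) ¬px qx with P? y | Q? y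
    ... | yes _ | yes _ = s≤s (length-filter-< x∈ys ¬px qx)
    ... | yes py | no ¬qy = contradiction (P⇒Q py) ¬qy
    ... | no _ | yes _ = m<n⇒m<1+n (length-filter-< x∈ys ¬px qx)
    ... | no _ | no _ = length-filter-< x∈ys ¬px qx

  functions : ∀ {A : Set} → List A → ∀ n → List (Fin n → A)
  functions xs zero = (λ ()) ∷ []
  functions xs (suc n) = concatMap (λ x → map (x Vector.∷_) (functions xs n)) xs

  length-functions : ∀ {A : Set} (xs : List A) n → length (functions xs n) ≤ length xs ^ n
  length-functions xs zero = ≤-refl
  length-functions xs (suc n) =
    ≤-trans (length-concatMap-≤ (λ x → map (x Vector.∷_) (functions xs n))
                                (λ x → ≤-reflexive (length-map (x Vector.∷_) (functions xs n))) xs)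
            (*-monoʳ-≤ (length xs) (length-functions xs n))

  functions-complete : ∀ {A : Set} {xs : List A} → (∀ x → x ∈ xs) → ∀ n (f : Fin n → A) → Any (_≗ f) (functions xs n)
  functions-complete all zero f = here (λ ())
  functions-complete {xs = xs} all (suc n) f =
    concatMap⁺ (λ x → map (x Vector.∷_) (functions xs n))
      (lose (all (f zero)) (map⁺ (Any.map (λ g≗f∘suc → λ { zero → refl ; (suc i) → g≗f∘suc i })
                                            (functions-complete all n (f ∘ suc)))))

  opaque
    pairs : ∀ n → List (Fin n × Fin n)
    pairs n = cartesianProduct (allFin n) (allFin n)

    length-pairs : ∀ n → length (pairs n) ≡ n * n
    length-pairs n = trans (length-cartesianProduct (allFin n) (allFin n))
                           (cong₂ _*_ (length-tabulate {n = n} (λ i → i)) (length-tabulate {n = n} (λ i → i)))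

    ∈-pairs : ∀ {n} (i j : Fin n) → (i , j) ∈ pairs n
    ∈-pairs i j = ∈-cartesianProduct⁺ (∈-allFin i) (∈-allFin j)


module Signs where

  open import Data.List using (List; []; _∷_)
  open import Data.List.Relation.Unary.All as All using (All; []; _∷_)
  open import Data.Product using (Σ; _,_; _×_)
  open import Data.Rational
    using (ℚ; 0ℚ; 1ℚ; _+_; _*_; -_; _-_; _÷_; 1/_; ∣_∣; _⊓_; _<_; _≤_; NonZero; positive; negative; nonNegative)
  open import Data.Rational.Properties
  open import Data.Rational.Solver using (module +-*-Solver)
  open import Data.Sum using (inj₁; inj₂)
  open import Function using (_$_)
  open import Function.Bundles using (_⇔_; mk⇔)
  open import Relation.Binary.Definitions using (tri<; tri≈; tri>)
  open import Relation.Binary.PropositionalEquality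
  open import Relation.Nullary using (¬_; yes; no; contradiction)
  open +-*-Solver

  pos*pos : ∀ {u v} → 0ℚ < u → 0ℚ < v → 0ℚ < u * v
  pos*pos {u} {v} u>0 v>0 = positive⁻¹ _ {{pos*pos⇒pos u {{positive u>0}} v {{positive v>0}}}}

  pos+pos : ∀ {u v} → 0ℚ < u → 0ℚ < v → 0ℚ < u + v
  pos+pos {u} {v} u>0 v>0 = subst (_< u + v) (+-identityˡ 0ℚ) (+-mono-< u>0 v>0)

  neg*neg : ∀ {u v} → u < 0ℚ → v < 0ℚ → 0ℚ < u * v
  neg*neg {u} {v} u<0 v<0 = positive⁻¹ _ {{neg*neg⇒pos u {{negative u<0}} v {{negative v<0}}}}

  p<q⇒0<q-p : ∀ {p q} → p < q → 0ℚ < q - p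
  p<q⇒0<q-p {p} {q} p<q = subst (_< q - p) (+-inverseʳ p) (+-monoˡ-< (- p) p<q)

  0<q-p⇒p<q : ∀ {p q} → 0ℚ < q - p → p < q
  0<q-p⇒p<q {p} {q} 0<q-p = subst₂ _<_ (+-identityˡ p) (solve 2 (λ p q → q :- p :+ p := q) refl p q) (+-monoˡ-< p 0<q-p)

  -p≤∣p∣ : ∀ p → - p ≤ ∣ p ∣
  -p≤∣p∣ p with ∣p∣≡p∨∣p∣≡-p p
  ... | inj₁ ∣p∣≡p = ≤-trans (neg-antimono-≤ (∣p∣≡p⇒0≤p ∣p∣≡p)) (0≤∣p∣ p)
  ... | inj₂ ∣p∣≡-p = ≤-reflexive (sym ∣p∣≡-p)

  p*p≡∣p∣*∣p∣ : ∀ p → p * p ≡ ∣ p ∣ * ∣ p ∣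
  p*p≡∣p∣*∣p∣ p with ∣p∣≡p∨∣p∣≡-p p
  ... | inj₁ ∣p∣≡p rewrite ∣p∣≡p = refl
  ... | inj₂ ∣p∣≡-p rewrite ∣p∣≡-p = solve 1 (λ p → p :* p := (:- p) :* (:- p)) refl p

  ∣p∣>0 : ∀ {p} → p ≢ 0ℚ → 0ℚ < ∣ p ∣
  ∣p∣>0 {p} p≢0 with <-cmp p 0ℚ
  ... | tri< p<0 _ _ = subst (0ℚ <_) (trans (sym (0≤p⇒∣p∣≡p (<⇒≤ -p>0))) (∣-p∣≡∣p∣ p)) -p>0
    where
    -p>0 : 0ℚ < - p
    -p>0 = neg-antimono-< p<0
  ... | tri≈ _ p≡0 _ = contradiction p≡0 p≢0
  ... | tri> _ _ p>0 = subst (0ℚ <_) (sym (0≤p⇒∣p∣≡p (<⇒≤ p>0))) p>0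

  1+∣p∣>0 : ∀ p → 0ℚ < 1ℚ + ∣ p ∣
  1+∣p∣>0 p = <-≤-trans (positive⁻¹ 1ℚ) (subst (_≤ 1ℚ + ∣ p ∣) (+-identityʳ 1ℚ) (+-monoʳ-≤ 1ℚ (0≤∣p∣ p)))

  record SameSign (x y : ℚ) : Set where
    constructor sameSign
    field product>0 : 0ℚ < x * y

  sameSign-refl : ∀ {x} → x ≢ 0ℚ → SameSign x x
  sameSign-refl {x} x≢0 with <-cmp x 0ℚ
  ... | tri< x<0 _ _ = sameSign (neg*neg x<0 x<0)
  ... | tri≈ _ x≡0 _ = contradiction x≡0 x≢0
  ... | tri> _ _ x>0 = sameSign (pos*pos x>0 x>0)

  sameSign-sym : ∀ {x y} → SameSign x y → SameSign y x
  sameSign-sym {x} {y} (sameSign xy>0) = sameSign (subst (0ℚ <_) (*-comm x y) xy>0)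

  sameSign⇒≢0 : ∀ {x y} → SameSign x y → y ≢ 0ℚ
  sameSign⇒≢0 {x} (sameSign xy>0) refl = <-irrefl (sym (*-zeroʳ x)) xy>0

  sameSign-trans : ∀ {x y z} → SameSign x y → SameSign y z → SameSign x z
  sameSign-trans {x} {y} {z} xy@(sameSign xy>0) (sameSign yz>0) = sameSign $
    *-cancelʳ-<-nonNeg (y * y) {{nonNegative (<⇒≤ yy>0)}}
      (subst₂ _<_ (sym (*-zeroˡ (y * y))) regroup (pos*pos xy>0 yz>0))
    where
    yy>0 : 0ℚ < y * y
    yy>0 = SameSign.product>0 (sameSign-refl (sameSign⇒≢0 xy))
    regroup : (x * y) * (y * z) ≡ (x * z) * (y * y)
    regroup = solve 3 (λ x y z → (x :* y) :* (y :* z) := (x :* z) :* (y :* y)) refl x y z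

  sameSign-pos : ∀ {x y} → SameSign x y → 0ℚ < y → 0ℚ < x
  sameSign-pos {x} {y} (sameSign xy>0) y>0 =
    *-cancelʳ-<-nonNeg y {{nonNegative (<⇒≤ y>0)}} (subst (_< x * y) (sym (*-zeroˡ y)) xy>0)

  sameSign-positive : ∀ {x y} → SameSign x y → 0ℚ < x ⇔ 0ℚ < y
  sameSign-positive x~y = mk⇔ (sameSign-pos (sameSign-sym x~y)) (sameSign-pos x~y)

  ¬sameSign⇒sameSign-neg : ∀ {x y} → x ≢ 0ℚ → y ≢ 0ℚ → ¬ SameSign x y → SameSign (- x) y
  ¬sameSign⇒sameSign-neg {x} {y} x≢0 y≢0 ¬xy with <-cmp x 0ℚ | <-cmp y 0ℚ
  ... | tri≈ _ x≡0 _ | _ = contradiction x≡0 x≢0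
  ... | _ | tri≈ _ y≡0 _ = contradiction y≡0 y≢0
  ... | tri< x<0 _ _ | tri< y<0 _ _ = contradiction (sameSign (neg*neg x<0 y<0)) ¬xy
  ... | tri> _ _ x>0 | tri> _ _ y>0 = contradiction (sameSign (pos*pos x>0 y>0)) ¬xy
  ... | tri< x<0 _ _ | tri> _ _ y>0 = sameSign (pos*pos (neg-antimono-< x<0) y>0)
  ... | tri> _ _ x>0 | tri< y<0 _ _ = sameSign (neg*neg (neg-antimono-< x>0) y<0)

  sameSign-perturb : ∀ v d → ∣ d ∣ < ∣ v ∣ → SameSign (v + d) v
  sameSign-perturb v d ∣d∣<∣v∣ = sameSign $ subst₂ _<_ (+-inverseˡ (d * v)) expand
    (+-monoˡ-< (d * v) (≤-<-trans (-p≤∣p∣ (d * v)) ∣dv∣<vv))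
    where
    ∣v∣>0 : 0ℚ < ∣ v ∣
    ∣v∣>0 = ≤-<-trans (0≤∣p∣ d) ∣d∣<∣v∣
    ∣dv∣<vv : ∣ d * v ∣ < v * v
    ∣dv∣<vv = subst₂ _<_ (sym (∣p*q∣≡∣p∣*∣q∣ d v)) (sym (p*p≡∣p∣*∣p∣ v))
      (*-monoˡ-<-pos ∣ v ∣ {{positive ∣v∣>0}} ∣d∣<∣v∣)
    expand : v * v + d * v ≡ (v + d) * v
    expand = solve 2 (λ v d → v :* v :+ d :* v := (v :+ d) :* v) refl v d

  module _ (b : ℚ) where
    private instance
      1+∣b∣≢0 : NonZero (1ℚ + ∣ b ∣)
      1+∣b∣≢0 = pos⇒nonZero (1ℚ + ∣ b ∣) {{positive (1+∣p∣>0 b)}}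

    -- ∣ v ∣ ÷ ∣ b ∣ would do, but is undefined for b = 0.
    tolerance : ℚ → ℚ
    tolerance v = ∣ v ∣ ÷ (1ℚ + ∣ b ∣)

    tolerance-pos : ∀ {v} → v ≢ 0ℚ → 0ℚ < tolerance v
    tolerance-pos v≢0 = pos*pos (∣p∣>0 v≢0) (positive⁻¹ _ {{1/pos⇒pos (1ℚ + ∣ b ∣) {{positive (1+∣p∣>0 b)}}}})

    sameSign-step : ∀ v t → v ≢ 0ℚ → ∣ t ∣ ≤ tolerance v → SameSign (v + t * b) v
    sameSign-step v t v≢0 ∣t∣≤τ = sameSign-perturb v (t * b) (begin-strict
      ∣ t * b ∣                                ≡⟨ ∣p*q∣≡∣p∣*∣q∣ t b ⟩
      ∣ t ∣ * ∣ b ∣                            ≤⟨ *-monoʳ-≤-nonNeg ∣ b ∣ {{nonNegative (0≤∣p∣ b)}} ∣t∣≤τ ⟩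
      τ * ∣ b ∣                                <⟨ subst (_< τ + τ * ∣ b ∣) (+-identityˡ (τ * ∣ b ∣))
                                                        (+-monoˡ-< (τ * ∣ b ∣) (tolerance-pos v≢0)) ⟩
      τ + τ * ∣ b ∣                            ≡⟨ solve 2 (λ τ c → τ :+ τ :* c := τ :* (con 1ℚ :+ c)) refl τ ∣ b ∣ ⟩
      τ * (1ℚ + ∣ b ∣)                         ≡⟨ *-assoc ∣ v ∣ (1/ (1ℚ + ∣ b ∣)) (1ℚ + ∣ b ∣) ⟩
      ∣ v ∣ * (1/ (1ℚ + ∣ b ∣) * (1ℚ + ∣ b ∣)) ≡⟨ cong (∣ v ∣ *_) (*-inverseˡ (1ℚ + ∣ b ∣)) ⟩
      ∣ v ∣ * 1ℚ                               ≡⟨ *-identityʳ ∣ v ∣ ⟩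
      ∣ v ∣                                    ∎)
      where
      open ≤-Reasoning
      τ : ℚ
      τ = tolerance v

  belowPositives : ∀ {A : Set} (f : A → ℚ) (xs : List A) →
                   Σ ℚ λ ε → 0ℚ < ε × All (λ x → 0ℚ < f x → ε < f x) xs
  belowPositives f [] = 1ℚ , positive⁻¹ 1ℚ , []
  belowPositives f (x ∷ xs) with belowPositives f xs | 0ℚ <? f x
  ... | ε , ε>0 , below | no fx≯0 = ε , ε>0 , (λ fx>0 → contradiction fx>0 fx≯0) ∷ below
  ... | ε , ε>0 , below | yes fx>0 with <-dense min>0
    where
    min>0 : 0ℚ < f x ⊓ ε
    min>0 with ⊓-sel (f x) ε
    ... | inj₁ eq = subst (0ℚ <_) (sym eq) fx>0
    ... | inj₂ eq = subst (0ℚ <_) (sym eq) ε>0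
  ...   | δ , δ>0 , δ<min = δ , δ>0 , (λ _ → <-≤-trans δ<min (p⊓q≤p (f x) ε))
                                     ∷ All.map (λ ε<fy fy>0 → <-trans (<-≤-trans δ<min (p⊓q≤q (f x) ε)) (ε<fy fy>0)) below

  module _ {t t′ d : ℚ} where

    lowered-threshold : t′ < t → (d < t → d < t′) → (t ≤ d ⇔ t′ < d) × d ≢ t′
    lowered-threshold t′<t below =
      mk⇔ (λ t≤d → <-≤-trans t′<t t≤d) (λ t′<d → ≮⇒≥ (λ d<t → <-asym (below d<t) t′<d)) ,
      λ { refl → <-irrefl refl (below t′<t) }

    raised-threshold : t < t′ → (t < d → t′ < d) → (d ≤ t ⇔ d < t′) × d ≢ t′
    raised-threshold t<t′ above =
      mk⇔ (λ d≤t → ≤-<-trans d≤t t<t′) (λ d<t′ → ≮⇒≥ (λ t<d → <-asym (above t<d) d<t′)) ,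
      λ { refl → <-irrefl refl (above t<t′) }


module AffineForms where

  open import Algebra.Bundles using (CommutativeRing)
  open import Data.Fin using (Fin; punchIn)
  open import Data.Fin.Properties using (punchInᵢ≢i)
  open import Data.Nat using (ℕ; suc)
  open import Data.Rational
    using (ℚ; 0ℚ; 1ℚ; _+_; _*_; -_; _-_; _÷_; 1/_; NonZero; ≢-nonZero)
  open import Data.Rational.Properties
  open import Data.Rational.Solver using (module +-*-Solver)
  open import Data.Vec.Functional using (Vector; removeAt; insertAt; updateAt)
  open import Data.Vec.Functional.Properties using (updateAt-updates; updateAt-minimal; insertAt-lookup; insertAt-punchIn)
  open import Relation.Binary.PropositionalEquality
  open +-*-Solver
  open import Algebra.Properties.Semiring.Sum (CommutativeRing.semiring +-*-commutativeRing)
    using (sum; sum-remove; sum-cong-≗; sum-replicate-zero; ∑-distrib-+; *-distribˡ-sum)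

  private variable K : ℕ

  Point : ℕ → Set
  Point = Vector ℚ

  infix 8 _·_
  _·_ : Vector ℚ K → Point K → ℚ
  a · x = sum (λ i → a i * x i)

  record AffineForm (K : ℕ) : Set where
    constructor affine
    field
      coeff : Vector ℚ K
      const : ℚ
  open AffineForm public

  sum-linear : ∀ p q (u v : Vector ℚ K) → sum (λ i → p * u i + q * v i) ≡ p * sum u + q * sum v
  sum-linear p q u v = trans (∑-distrib-+ (λ i → p * u i) (λ i → q * v i))
                             (sym (cong₂ _+_ (*-distribˡ-sum p u) (*-distribˡ-sum q v)))

  combine : ℚ → AffineForm K → ℚ → AffineForm K → AffineForm K
  combine p f q g = affine (λ i → p * coeff f i + q * coeff g i) (p * const f + q * const g)

  drop : Fin (suc K) → AffineForm (suc K) → AffineForm K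
  drop c h = affine (removeAt (coeff h) c) (const h)

  -- Opaque, so that unification and conversion checking never unfold the arithmetic of ℚ.
  opaque
    eval : AffineForm K → Point K → ℚ
    eval f x = coeff f · x + const f

    eval-combine : ∀ p (f : AffineForm K) q g x → eval (combine p f q g) x ≡ p * eval f x + q * eval g x
    eval-combine p f q g x = begin
      sum (λ i → (p * coeff f i + q * coeff g i) * x i) + (p * const f + q * const g)
        ≡⟨ cong (_+ (p * const f + q * const g))
                (trans (sum-cong-≗ distribute) (sum-linear p q (λ i → coeff f i * x i) (λ i → coeff g i * x i))) ⟩
      p * (coeff f · x) + q * (coeff g · x) + (p * const f + q * const g)
        ≡⟨ solve 6 (λ p q a b c d → p :* a :+ q :* b :+ (p :* c :+ q :* d) := p :* (a :+ c) :+ q :* (b :+ d))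
             refl p q (coeff f · x) (coeff g · x) (const f) (const g) ⟩
      p * eval f x + q * eval g x ∎
      where
      open ≡-Reasoning
      distribute : ∀ i → (p * coeff f i + q * coeff g i) * x i ≡ p * (coeff f i * x i) + q * (coeff g i * x i)
      distribute i = solve 5 (λ p q a b x → (p :* a :+ q :* b) :* x := p :* (a :* x) :+ q :* (b :* x))
                       refl p q (coeff f i) (coeff g i) (x i)

    eval-affine : ∀ (f : AffineForm K) p q x y → p + q ≡ 1ℚ →
                  eval f (λ i → p * x i + q * y i) ≡ p * eval f x + q * eval f y
    eval-affine f p q x y p+q≡1 = begin
      sum (λ i → coeff f i * (p * x i + q * y i)) + const f
        ≡⟨ cong₂ _+_ (trans (sum-cong-≗ distribute)
                            (sum-linear p q (λ i → coeff f i * x i) (λ i → coeff f i * y i)))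
                     (trans (sym (*-identityˡ (const f))) (cong (_* const f) (sym p+q≡1))) ⟩
      p * (coeff f · x) + q * (coeff f · y) + (p + q) * const f
        ≡⟨ solve 5 (λ p q a b c → p :* a :+ q :* b :+ (p :+ q) :* c := p :* (a :+ c) :+ q :* (b :+ c))
             refl p q (coeff f · x) (coeff f · y) (const f) ⟩
      p * eval f x + q * eval f y ∎
      where
      open ≡-Reasoning
      distribute : ∀ i → coeff f i * (p * x i + q * y i) ≡ p * (coeff f i * x i) + q * (coeff f i * y i)
      distribute i = solve 5 (λ a p q x y → a :* (p :* x :+ q :* y) := p :* (a :* x) :+ q :* (a :* y))
                       refl (coeff f i) p q (x i) (y i)

    eval-drop : ∀ c (h : AffineForm (suc K)) x → eval h x ≡ coeff h c * x c + eval (drop c h) (removeAt x c)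
    eval-drop c h x = trans (cong (_+ const h) (sum-remove (λ i → coeff h i * x i)))
                            (+-assoc (coeff h c * x c) _ (const h))

    eval-cong : ∀ (f : AffineForm K) {x y} → x ≗ y → eval f x ≡ eval f y
    eval-cong f x≗y = cong (_+ const f) (sum-cong-≗ (λ i → cong (coeff f i *_) (x≗y i)))

    eval-const : ∀ {K} (f : AffineForm K) → (∀ i → coeff f i ≡ 0ℚ) → ∀ x → eval f x ≡ const f
    eval-const {K} f coeff≡0 x = trans (cong (_+ const f)
      (trans (sum-cong-≗ (λ i → trans (cong (_* x i) (coeff≡0 i)) (*-zeroˡ (x i)))) (sum-replicate-zero K)))
      (+-identityˡ (const f))

  infixl 6 _⊕_ _⊖_
  _⊕_ _⊖_ : AffineForm K → AffineForm K → AffineForm K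
  f ⊕ g = combine 1ℚ f 1ℚ g
  f ⊖ g = combine 1ℚ f (- 1ℚ) g

  eval-⊕ : ∀ (f g : AffineForm K) x → eval (f ⊕ g) x ≡ eval f x + eval g x
  eval-⊕ f g x = trans (eval-combine 1ℚ f 1ℚ g x)
                       (solve 2 (λ u v → con 1ℚ :* u :+ con 1ℚ :* v := u :+ v) refl (eval f x) (eval g x))

  eval-⊖ : ∀ (f g : AffineForm K) x → eval (f ⊖ g) x ≡ eval f x - eval g x
  eval-⊖ f g x = trans (eval-combine 1ℚ f (- 1ℚ) g x)
                       (solve 2 (λ u v → con 1ℚ :* u :+ (:- con 1ℚ) :* v := u :- v) refl (eval f x) (eval g x))

  unit : Fin K → AffineForm K
  unit c = affine (updateAt (λ _ → 0ℚ) c (λ _ → 1ℚ)) 0ℚ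

  eval-unit : ∀ {K} (c : Fin (suc K)) x → eval (unit c) x ≡ x c
  eval-unit c x = begin
    eval (unit c) x
      ≡⟨ eval-drop c (unit c) x ⟩
    coeff (unit c) c * x c + eval (drop c (unit c)) (removeAt x c)
      ≡⟨ cong₂ (λ a r → a * x c + r) (updateAt-updates c (λ _ → 0ℚ))
               (eval-const (drop c (unit c)) (λ j → updateAt-minimal (punchIn c j) c (λ _ → 0ℚ) (punchInᵢ≢i c j)) _) ⟩
    1ℚ * x c + 0ℚ
      ≡⟨ solve 1 (λ x → con 1ℚ :* x :+ con 0ℚ := x) refl (x c) ⟩
    x c ∎
    where open ≡-Reasoning

  shift : Point K → Fin K → ℚ → Point K
  shift x c t = updateAt x c (_+ t)

  eval-shift : ∀ {K} (f : AffineForm (suc K)) x c t → eval f (shift x c t) ≡ eval f x + t * coeff f c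
  eval-shift f x c t = begin
    eval f (shift x c t)
      ≡⟨ eval-drop c f (shift x c t) ⟩
    coeff f c * shift x c t c + eval (drop c f) (removeAt (shift x c t) c)
      ≡⟨ cong₂ (λ u r → coeff f c * u + r) (updateAt-updates c x)
               (eval-cong (drop c f) (λ j → updateAt-minimal (punchIn c j) c x (punchInᵢ≢i c j))) ⟩
    coeff f c * (x c + t) + eval (drop c f) (removeAt x c)
      ≡⟨ solve 4 (λ a u t r → a :* (u :+ t) :+ r := a :* u :+ r :+ t :* a) refl (coeff f c) (x c) t _ ⟩
    coeff f c * x c + eval (drop c f) (removeAt x c) + t * coeff f c
      ≡⟨ cong (_+ t * coeff f c) (sym (eval-drop c f x)) ⟩
    eval f x + t * coeff f c ∎
    where open ≡-Reasoning

  -- The hyperplane g = 0, parametrised by the coordinates other than c: lift solves g = 0 for the c-th one.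
  module Hyperplane {K} (g : AffineForm (suc K)) (c : Fin (suc K)) (gc≢0 : coeff g c ≢ 0ℚ) where
    private instance
      gc-nonZero : NonZero (coeff g c)
      gc-nonZero = ≢-nonZero gc≢0

    lift : Point K → Point (suc K)
    lift q = insertAt q c (- eval (drop c g) q ÷ coeff g c)

    restrict : AffineForm (suc K) → AffineForm K
    restrict h = combine 1ℚ (drop c h) (- (coeff h c ÷ coeff g c)) (drop c g)

    eval-lift : ∀ h q → eval h (lift q) ≡ coeff h c * (- eval (drop c g) q ÷ coeff g c) + eval (drop c h) q
    eval-lift h q = trans (eval-drop c h (lift q))
      (cong₂ (λ u r → coeff h c * u + r) (insertAt-lookup q c _) (eval-cong (drop c h) (insertAt-punchIn q c _)))

    eval-restrict : ∀ h q → eval (restrict h) q ≡ eval h (lift q)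
    eval-restrict h q = trans (eval-combine 1ℚ (drop c h) (- (coeff h c ÷ coeff g c)) (drop c g) q)
      (trans (solve 4 (λ H G a i → con 1ℚ :* H :+ (:- (a :* i)) :* G := a :* (:- G :* i) :+ H) refl
                (eval (drop c h) q) (eval (drop c g) q) (coeff h c) (1/ coeff g c))
             (sym (eval-lift h q)))

    lift-on-hyperplane : ∀ q → eval g (lift q) ≡ 0ℚ
    lift-on-hyperplane q = trans (eval-lift g q)
      (trans (solve 3 (λ G a i → a :* (:- G :* i) :+ G := G :* (con 1ℚ :- a :* i)) refl
                (eval (drop c g) q) (coeff g c) (1/ coeff g c))
        (trans (cong (λ u → eval (drop c g) q * (1ℚ - u)) (*-inverseʳ (coeff g c)))
               (solve 1 (λ G → G :* (con 1ℚ :- con 1ℚ) := con 0ℚ) refl (eval (drop c g) q))))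

    lift-removeAt : ∀ h x → eval g x ≡ 0ℚ → eval h (lift (removeAt x c)) ≡ eval h x
    lift-removeAt h x gx≡0 = begin
      eval h (lift (removeAt x c))
        ≡⟨ eval-lift h (removeAt x c) ⟩
      coeff h c * (- G ÷ coeff g c) + eval (drop c h) (removeAt x c)
        ≡⟨ cong (λ u → coeff h c * u + eval (drop c h) (removeAt x c)) solved ⟩
      coeff h c * x c + eval (drop c h) (removeAt x c)
        ≡⟨ sym (eval-drop c h x) ⟩
      eval h x ∎
      where
      open ≡-Reasoning
      G = eval (drop c g) (removeAt x c)
      solved : - G ÷ coeff g c ≡ x c
      solved = begin
        - G ÷ coeff g c
          ≡⟨ solve 4 (λ G a i u → :- G :* i := u :* (a :* i) :- (a :* u :+ G) :* i) refl
                     G (coeff g c) (1/ coeff g c) (x c) ⟩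
        x c * (coeff g c * (1/ coeff g c)) - (coeff g c * x c + G) * (1/ coeff g c)
          ≡⟨ cong₂ (λ u v → x c * u - v * (1/ coeff g c))
                   (*-inverseʳ (coeff g c)) (trans (sym (eval-drop c g x)) gx≡0) ⟩
        x c * 1ℚ - 0ℚ * (1/ coeff g c)
          ≡⟨ solve 2 (λ u i → u :* con 1ℚ :- con 0ℚ :* i := u) refl (x c) (1/ coeff g c) ⟩
        x c ∎

module Arrangements where

  open import Data.Fin using (Fin)
  open import Data.Fin.Properties using (all?; ¬∀⟶∃¬)
  open import Data.List using (List; []; _∷_; _++_; length; map; concatMap)
  open import Data.List.Properties using (length-++; length-map)
  open import Data.List.Membership.Propositional using (_∈_; find; lose)
  open import Data.List.Relation.Unary.All as All using (All; []; _∷_)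
  import Data.List.Relation.Unary.All.Properties as All
  open import Data.List.Relation.Unary.Any as Any using (Any; here; there)
  open import Data.List.Relation.Unary.Any.Properties using (++⁺ˡ; ++⁺ʳ; concatMap⁺)
  open import Data.Nat as ℕ using (ℕ; zero; suc)
  import Data.Nat.Properties as ℕ
  import Data.Nat.Solver as ℕ-Solver
  open import Data.Product using (Σ; Σ-syntax; _,_; _×_; proj₁; proj₂)
  open import Data.Rational using (ℚ; 0ℚ; 1ℚ; _+_; _*_; -_; _-_; _÷_; 1/_; ∣_∣; _<_; _≤_; _<?_; _≟_; NonZero; positive)
  open import Data.Rational.Properties
  open import Data.Rational.Solver using (module +-*-Solver)
  open import Data.Vec.Functional using (removeAt)
  open import Relation.Binary.Definitions using (tri<; tri≈; tri>)
  open import Relation.Binary.PropositionalEquality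
  open import Relation.Nullary using (¬_; Dec; yes; no)
  open Signs
  open AffineForms
  open Enumeration using (length-concatMap-≤)

  private variable K : ℕ

  _≈[_]_ : Point K → List (AffineForm K) → Point K → Set
  x ≈[ fs ] y = All (λ f → SameSign (eval f x) (eval f y)) fs

  Avoids : List (AffineForm K) → Point K → Set
  Avoids fs x = All (λ f → eval f x ≢ 0ℚ) fs

  -- W meets every open cell of the arrangement of the hyperplanes f = 0, f ∈ fs.
  Represents : List (AffineForm K) → List (Point K) → Set
  Represents fs W = ∀ ω → Avoids fs ω → Any (_≈[ fs ] ω) W

  ≈-trans : ∀ {fs : List (AffineForm K)} {x y z} → x ≈[ fs ] y → y ≈[ fs ] z → x ≈[ fs ] z
  ≈-trans x≈y y≈z = All.zipWith (λ (p , q) → sameSign-trans p q) (x≈y , y≈z)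

  ≈-sym : ∀ {fs : List (AffineForm K)} {x y} → x ≈[ fs ] y → y ≈[ fs ] x
  ≈-sym = All.map sameSign-sym

  ≈⇒avoids : ∀ {fs : List (AffineForm K)} {x y} → x ≈[ fs ] y → Avoids fs x
  ≈⇒avoids = All.map (λ fx~fy → sameSign⇒≢0 (sameSign-sym fx~fy))

  -- q is the point where the segment from x to y crosses g = 0.
  crossing : ∀ {K} (g : AffineForm K) (fs : List (AffineForm K)) (x y : Point K) →
             0ℚ < eval g x → SameSign (- eval g x) (eval g y) → x ≈[ fs ] y →
             Σ[ q ∈ Point K ] eval g q ≡ 0ℚ × q ≈[ fs ] y
  crossing {K} g fs x y α>0 opposite x≈y = q , g[q]≡0 , All.map (λ {f} → sign {f}) x≈y
    where
    open +-*-Solver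
    α β : ℚ
    α = eval g x
    β = eval g y
    -β>0 : 0ℚ < - β
    -β>0 = sameSign-pos (sameSign (subst (0ℚ <_) (solve 2 (λ a b → (:- a) :* b := (:- b) :* a) refl α β)
                                           (SameSign.product>0 opposite))) α>0
    α-β>0 : 0ℚ < α - β
    α-β>0 = pos+pos α>0 -β>0
    instance
      α-β≢0 : NonZero (α - β)
      α-β≢0 = pos⇒nonZero (α - β) {{positive α-β>0}}
    1/[α-β]>0 : 0ℚ < 1/ (α - β)
    1/[α-β]>0 = positive⁻¹ _ {{1/pos⇒pos (α - β) {{positive α-β>0}}}}
    s t : ℚ
    s = - β ÷ (α - β)
    t = α ÷ (α - β)
    s>0 : 0ℚ < s
    s>0 = pos*pos -β>0 1/[α-β]>0
    t>0 : 0ℚ < t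
    t>0 = pos*pos α>0 1/[α-β]>0
    s+t≡1 : s + t ≡ 1ℚ
    s+t≡1 = trans (solve 3 (λ a b i → (:- b) :* i :+ a :* i := (a :- b) :* i) refl α β (1/ (α - β)))
                  (*-inverseʳ (α - β))
    q : Point K
    q i = s * x i + t * y i
    eval-q : ∀ f → eval f q ≡ s * eval f x + t * eval f y
    eval-q f = eval-affine f s t x y s+t≡1
    g[q]≡0 : eval g q ≡ 0ℚ
    g[q]≡0 = trans (eval-q g) (solve 3 (λ a b i → (:- b) :* i :* a :+ a :* i :* b := con 0ℚ) refl α β (1/ (α - β)))
    sign : ∀ {f} → SameSign (eval f x) (eval f y) → SameSign (eval f q) (eval f y)
    sign {f} fx~fy = sameSign (subst (0ℚ <_)
      (trans (solve 4 (λ s t u v → s :* (u :* v) :+ t :* (v :* v) := (s :* u :+ t :* v) :* v) refl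
                s t (eval f x) (eval f y))
             (cong (_* eval f y) (sym (eval-q f))))
      (pos+pos (pos*pos s>0 (SameSign.product>0 fx~fy))
               (pos*pos t>0 (SameSign.product>0 (sameSign-refl (sameSign⇒≢0 fx~fy))))))

  toHyperplane : ∀ {K} (g : AffineForm K) (fs : List (AffineForm K)) (w ω : Point K) → eval g ω ≢ 0ℚ →
                 ¬ SameSign (eval g w) (eval g ω) → w ≈[ fs ] ω → Σ[ q ∈ Point K ] eval g q ≡ 0ℚ × q ≈[ fs ] ω
  toHyperplane g fs w ω gω≢0 ¬same w≈ω with <-cmp (eval g w) 0ℚ
  ... | tri≈ _ gw≡0 _ = w , gw≡0 , w≈ω
  ... | tri> _ _ gw>0 = crossing g fs w ω gw>0 (¬sameSign⇒sameSign-neg (≢-sym (<⇒≢ gw>0)) gω≢0 ¬same) w≈ω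
  ... | tri< gw<0 _ _ =
    let q , g[q]≡0 , q≈w = crossing g fs ω w gω>0 opposite (≈-sym w≈ω) in q , g[q]≡0 , ≈-trans q≈w w≈ω
    where
    open +-*-Solver
    -gw~gω : SameSign (- eval g w) (eval g ω)
    -gw~gω = ¬sameSign⇒sameSign-neg (<⇒≢ gw<0) gω≢0 ¬same
    gω>0 : 0ℚ < eval g ω
    gω>0 = sameSign-pos (sameSign-sym -gw~gω) (neg-antimono-< gw<0)
    opposite : SameSign (- eval g ω) (eval g w)
    opposite = sameSign (subst (0ℚ <_) (solve 2 (λ a b → (:- a) :* b := (:- b) :* a) refl (eval g w) (eval g ω))
                                       (SameSign.product>0 -gw~gω))

  module _ {K} (fs : List (AffineForm (suc K))) (c : Fin (suc K)) (p : Point (suc K)) where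

    private
      τ : AffineForm (suc K) → ℚ
      τ f = tolerance (coeff f c) (eval f p)
      tolerances : Σ ℚ λ ε → 0ℚ < ε × All (λ f → 0ℚ < τ f → ε < τ f) fs
      tolerances = belowPositives τ fs
      ε : ℚ
      ε = proj₁ tolerances
      ε>0 : 0ℚ < ε
      ε>0 = proj₁ (proj₂ tolerances)

    offHyperplane : List (Point (suc K))
    offHyperplane = shift p c ε ∷ shift p c (- ε) ∷ []

    shift-≈ : Avoids fs p → ∀ t → ∣ t ∣ ≡ ε → shift p c t ≈[ fs ] p
    shift-≈ avoids t ∣t∣≡ε = All.zipWith (λ {f} (fp≢0 , ε<τ) →
        subst (λ v → SameSign v (eval f p)) (sym (eval-shift f p c t))
              (sameSign-step (coeff f c) (eval f p) t fp≢0
                (subst (_≤ _) (sym ∣t∣≡ε) (<⇒≤ (ε<τ (tolerance-pos (coeff f c) fp≢0))))))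
      (avoids , proj₂ (proj₂ tolerances))

    shift-sign : ∀ g → eval g p ≡ 0ℚ → ∀ t ω → 0ℚ < t * coeff g c * eval g ω →
                 SameSign (eval g (shift p c t)) (eval g ω)
    shift-sign g gp≡0 t ω pos = sameSign (subst (λ v → 0ℚ < v * eval g ω)
      (sym (trans (eval-shift g p c t) (trans (cong (_+ t * coeff g c) gp≡0) (+-identityˡ (t * coeff g c))))) pos)

    offHyperplane-represents : ∀ g → coeff g c ≢ 0ℚ → eval g p ≡ 0ℚ → Avoids fs p →
                               ∀ ω → eval g ω ≢ 0ℚ → p ≈[ fs ] ω → Any (_≈[ g ∷ fs ] ω) offHyperplane
    offHyperplane-represents g gc≢0 gp≡0 avoids ω gω≢0 p≈ω with 0ℚ <? coeff g c * eval g ω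
    ... | yes gc~gω =
      here (shift-sign g gp≡0 ε ω (subst (0ℚ <_) (sym (*-assoc ε (coeff g c) (eval g ω))) (pos*pos ε>0 gc~gω))
            ∷ ≈-trans {fs = fs} (shift-≈ avoids ε (0≤p⇒∣p∣≡p (<⇒≤ ε>0))) p≈ω)
    ... | no gc≁gω =
      there (here (shift-sign g gp≡0 (- ε) ω (subst (0ℚ <_) flip (pos*pos ε>0 -gc~gω))
                   ∷ ≈-trans {fs = fs} (shift-≈ avoids (- ε) (trans (∣-p∣≡∣p∣ ε) (0≤p⇒∣p∣≡p (<⇒≤ ε>0)))) p≈ω))
      where
      open +-*-Solver
      -gc~gω : 0ℚ < - coeff g c * eval g ω
      -gc~gω = SameSign.product>0 (¬sameSign⇒sameSign-neg gc≢0 gω≢0 (λ s → gc≁gω (SameSign.product>0 s)))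
      flip : ε * (- coeff g c * eval g ω) ≡ - ε * coeff g c * eval g ω
      flip = solve 3 (λ e a b → e :* ((:- a) :* b) := (:- e) :* a :* b) refl ε (coeff g c) (eval g ω)

  module _ {K} (g : AffineForm (suc K)) (fs : List (AffineForm (suc K))) (c : Fin (suc K)) (gc≢0 : coeff g c ≢ 0ℚ) where
    open Hyperplane g c gc≢0

    -- Cells not cut by g are represented in W₁; a cell cut by g meets g = 0 in a cell of the restricted
    -- arrangement, represented in W₂, and is reached from there by stepping off the hyperplane.
    split : List (Point (suc K)) → List (Point K) → List (Point (suc K))
    split W₁ W₂ = W₁ ++ concatMap (λ q → offHyperplane fs c (lift q)) W₂

    fromHyperplane : ∀ {W₂} → Represents (map restrict fs) W₂ →
                     ∀ q ω → eval g q ≡ 0ℚ → q ≈[ fs ] ω → eval g ω ≢ 0ℚ →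
                     Any (_≈[ g ∷ fs ] ω) (concatMap (λ q → offHyperplane fs c (lift q)) W₂)
    fromHyperplane rep₂ q ω g[q]≡0 q≈ω gω≢0 =
      let q₁ , q₁∈ , q₁≈q₀ = find (rep₂ (removeAt q c) avoids₀)
          p≈ω : lift q₁ ≈[ fs ] ω
          p≈ω = ≈-trans (All.map (λ {f} s → subst₂ SameSign (eval-restrict f q₁) (restrict-q f) s) (All.map⁻ q₁≈q₀)) q≈ω
      in concatMap⁺ (λ q → offHyperplane fs c (lift q))
           (lose q₁∈ (offHyperplane-represents fs c (lift q₁) g gc≢0 (lift-on-hyperplane q₁) (≈⇒avoids p≈ω) ω gω≢0 p≈ω))
      where
      restrict-q : ∀ f → eval (restrict f) (removeAt q c) ≡ eval f q
      restrict-q f = trans (eval-restrict f (removeAt q c)) (lift-removeAt f q g[q]≡0)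
      avoids₀ : Avoids (map restrict fs) (removeAt q c)
      avoids₀ = All.map⁺ (All.map (λ {f} fq≢0 → subst (_≢ 0ℚ) (sym (restrict-q f)) fq≢0) (≈⇒avoids q≈ω))

    split-represents : ∀ {W₁ W₂} → Represents fs W₁ → Represents (map restrict fs) W₂ →
                       Represents (g ∷ fs) (split W₁ W₂)
    split-represents {W₁} {W₂} rep₁ rep₂ ω (gω≢0 ∷ avoids) =
      let w , w∈ , w≈ω = find (rep₁ ω avoids) in cases w w∈ w≈ω (0ℚ <? eval g w * eval g ω)
      where
      cases : ∀ w → w ∈ W₁ → w ≈[ fs ] ω → Dec (0ℚ < eval g w * eval g ω) → Any (_≈[ g ∷ fs ] ω) (split W₁ W₂)
      cases w w∈ w≈ω (yes gw~gω) = ++⁺ˡ (lose w∈ (sameSign gw~gω ∷ w≈ω))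
      cases w w∈ w≈ω (no gw≁gω) =
        let q , g[q]≡0 , q≈ω = toHyperplane g fs w ω gω≢0 (λ s → gw≁gω (SameSign.product>0 s)) w≈ω
        in ++⁺ʳ W₁ (fromHyperplane rep₂ q ω g[q]≡0 q≈ω gω≢0)

  private
    split-bound : ∀ n K {a b} → a ℕ.≤ (1 ℕ.+ 2 ℕ.* n) ℕ.^ suc K → b ℕ.≤ (1 ℕ.+ 2 ℕ.* n) ℕ.^ K →
                  a ℕ.+ b ℕ.* 2 ℕ.≤ (1 ℕ.+ 2 ℕ.* suc n) ℕ.^ suc K
    split-bound n K a≤ b≤ = ℕ.≤-trans (ℕ.+-mono-≤ a≤ (ℕ.*-monoˡ-≤ 2 b≤)) (ℕ.≤-trans (ℕ.≤-reflexive regroup)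
      (ℕ.*-monoʳ-≤ (1 ℕ.+ 2 ℕ.* suc n) (ℕ.^-monoˡ-≤ K (ℕ.+-monoʳ-≤ 1 (ℕ.*-monoʳ-≤ 2 (ℕ.n≤1+n n))))))
      where
      open ℕ-Solver.+-*-Solver
      regroup : (1 ℕ.+ 2 ℕ.* n) ℕ.^ suc K ℕ.+ (1 ℕ.+ 2 ℕ.* n) ℕ.^ K ℕ.* 2 ≡ (1 ℕ.+ 2 ℕ.* suc n) ℕ.* (1 ℕ.+ 2 ℕ.* n) ℕ.^ K
      regroup = solve 2 (λ n y → (con 1 :+ con 2 :* n) :* y :+ y :* con 2 := (con 1 :+ con 2 :* (con 1 :+ n)) :* y)
                  refl n ((1 ℕ.+ 2 ℕ.* n) ℕ.^ K)

  Representatives : ∀ K → List (AffineForm K) → Set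
  Representatives K fs = Σ[ W ∈ List (Point K) ] length W ℕ.≤ (1 ℕ.+ 2 ℕ.* length fs) ℕ.^ K × Represents fs W

  representatives : ∀ K (fs : List (AffineForm K)) → Representatives K fs
  representatives K [] = (λ _ → 0ℚ) ∷ [] , ℕ.≤-reflexive (sym (ℕ.^-zeroˡ K)) , λ _ _ → here []
  representatives zero fs@(_ ∷ _) =
    (λ ()) ∷ [] , ℕ.≤-refl ,
    λ ω avoids → here (All.map (λ {f} fω≢0 → subst (λ v → SameSign v (eval f ω)) (eval-cong f (λ ()))
                                                    (sameSign-refl fω≢0))
                               avoids)
  representatives (suc K) (g ∷ fs) = cases (representatives (suc K) fs) (all? (λ c → coeff g c ≟ 0ℚ))
    where
    cases : Representatives (suc K) fs → Dec (∀ c → coeff g c ≡ 0ℚ) → Representatives (suc K) (g ∷ fs)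
    cases (W₁ , len₁ , rep₁) (yes g-constant) =
      W₁ , ℕ.≤-trans len₁ (ℕ.^-monoˡ-≤ (suc K) (ℕ.+-monoʳ-≤ 1 (ℕ.*-monoʳ-≤ 2 (ℕ.n≤1+n (length fs))))) ,
      λ { ω (gω≢0 ∷ avoids) → Any.map (λ {w} w≈ω → same-g w ω gω≢0 ∷ w≈ω) (rep₁ ω avoids) }
      where
      same-g : ∀ w ω → eval g ω ≢ 0ℚ → SameSign (eval g w) (eval g ω)
      same-g w ω gω≢0 = subst (λ v → SameSign v (eval g ω))
        (trans (eval-const g g-constant ω) (sym (eval-const g g-constant w))) (sameSign-refl gω≢0)
    cases (W₁ , len₁ , rep₁) (no g-varies) =
      let c , gc≢0 = ¬∀⟶∃¬ (suc K) _ (λ c → coeff g c ≟ 0ℚ) g-varies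
          open Hyperplane g c gc≢0 using (restrict; lift)
          W₂ , len₂ , rep₂ = representatives K (map restrict fs)
          len₂′ : length W₂ ℕ.≤ (1 ℕ.+ 2 ℕ.* length fs) ℕ.^ K
          len₂′ = subst (λ n → length W₂ ℕ.≤ (1 ℕ.+ 2 ℕ.* n) ℕ.^ K) (length-map restrict fs) len₂
          len-concat : length (concatMap (λ q → offHyperplane fs c (lift q)) W₂) ℕ.≤ length W₂ ℕ.* 2
          len-concat = length-concatMap-≤ (λ q → offHyperplane fs c (lift q)) (λ _ → ℕ.≤-refl) W₂
      in split g fs c gc≢0 W₁ W₂ ,
         ℕ.≤-trans (ℕ.≤-reflexive (length-++ W₁))
           (ℕ.≤-trans (ℕ.+-monoʳ-≤ (length W₁) len-concat) (split-bound (length fs) K len₁ len₂′)) ,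
         split-represents g fs c gc≢0 rep₁ rep₂


module FourPoint where

  open import Data.Fin using (Fin; zero; suc)
  open import Data.Nat using (suc)
  open import Data.Rational using (ℚ; 0ℚ; _+_; _≤_)
  open import Data.Rational.Properties
    using (≤-refl; ≤-trans; ≤-reflexive; +-comm; +-monoˡ-≤; +-monoʳ-≤; +-mono-≤; +-identityʳ)
  open import Data.Rational.Solver using (module +-*-Solver)
  open import Data.Sum using (_⊎_; inj₁; inj₂)
  open import Relation.Binary.PropositionalEquality
  open import Defs using (WTree; single; attach; dist)
  open +-*-Solver

  dist-self : ∀ {m} (t : WTree m) x → dist t x x ≡ 0ℚ
  dist-self single zero = refl
  dist-self (attach t p w _) zero = refl
  dist-self (attach t p w _) (suc i) = dist-self t i

  dist-sym : ∀ {m} (t : WTree m) x y → dist t x y ≡ dist t y x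
  dist-sym single zero zero = refl
  dist-sym (attach t p w _) zero zero = refl
  dist-sym (attach t p w _) zero (suc j) = refl
  dist-sym (attach t p w _) (suc i) zero = refl
  dist-sym (attach t p w _) (suc i) (suc j) = dist-sym t i j

  -- A ≤ max B C. Required for every ordering of four points, this is the four-point condition of tree metrics.
  NotAbove : ℚ → ℚ → ℚ → Set
  NotAbove A B C = A ≤ B ⊎ A ≤ C

  notAbove-shift : ∀ {A B C A′ B′ C′} s → A′ ≡ A + s → B′ ≡ B + s → C′ ≡ C + s → NotAbove A B C → NotAbove A′ B′ C′
  notAbove-shift s refl refl refl (inj₁ A≤B) = inj₁ (+-monoˡ-≤ s A≤B)
  notAbove-shift s refl refl refl (inj₂ A≤C) = inj₂ (+-monoˡ-≤ s A≤C)

  private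
    ≤+nonNeg : ∀ {B s} → 0ℚ ≤ s → B ≤ B + s
    ≤+nonNeg {B} {s} s≥0 = subst (_≤ B + s) (+-identityʳ B) (+-monoʳ-≤ B s≥0)

  notAbove-grow : ∀ {A B C A′ B′ C′} s → 0ℚ ≤ s → A′ ≡ A → B′ ≡ B + s → C′ ≡ C + s → NotAbove A B C → NotAbove A′ B′ C′
  notAbove-grow s s≥0 refl refl refl (inj₁ A≤B) = inj₁ (≤-trans A≤B (≤+nonNeg s≥0))
  notAbove-grow s s≥0 refl refl refl (inj₂ A≤C) = inj₂ (≤-trans A≤C (≤+nonNeg s≥0))

  private
    e-wab : ∀ w a b → (w + a) + b ≡ (a + b) + w
    e-wab = solve 3 (λ w a b → (w :+ a) :+ b := (a :+ b) :+ w) refl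

    e-awb : ∀ w a b → a + (w + b) ≡ (a + b) + w
    e-awb = solve 3 (λ w a b → a :+ (w :+ b) := (a :+ b) :+ w) refl

    e-ww : ∀ w a b → (w + a) + (w + b) ≡ (a + b) + (w + w)
    e-ww = solve 3 (λ w a b → (w :+ a) :+ (w :+ b) := (a :+ b) :+ (w :+ w)) refl

  -- The new leaf zero lies at distance w beyond p. If it occurs once among x y z u, every sum grows by w
  -- (notAbove-shift); if twice, the sum pairing its two occurrences is unchanged and the others grow by 2w.
  fourPoint : ∀ {m} (t : WTree m) x y z u →
              NotAbove (dist t x y + dist t z u) (dist t x z + dist t y u) (dist t x u + dist t y z)
  fourPoint single zero zero zero zero = inj₁ ≤-refl
  fourPoint (attach t p w w≥0) (suc i) (suc j) (suc k) (suc l) = fourPoint t i j k l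
  fourPoint {suc m} (attach t p w w≥0) zero (suc j) (suc k) (suc l) =
    notAbove-shift w (e-wab w (d p j) (d k l)) (e-wab w (d p k) (d j l)) (e-wab w (d p l) (d j k)) (fourPoint t p j k l)
    where
    d : Fin m → Fin m → ℚ
    d = dist t
  fourPoint {suc m} (attach t p w w≥0) (suc i) zero (suc k) (suc l) =
    notAbove-shift w (trans (cong (λ v → (w + v) + d k l) (dist-sym t p i)) (e-wab w (d i p) (d k l)))
                     (e-awb w (d i k) (d p l)) (e-awb w (d i l) (d p k)) (fourPoint t i p k l)
    where
    d : Fin m → Fin m → ℚ
    d = dist t
  fourPoint {suc m} (attach t p w w≥0) (suc i) (suc j) zero (suc l) =
    notAbove-shift w (e-awb w (d i j) (d p l)) (trans (cong (λ v → (w + v) + d j l) (dist-sym t p i)) (e-wab w (d i p) (d j l)))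
                     (trans (cong (λ v → d i l + (w + v)) (dist-sym t p j)) (e-awb w (d i l) (d j p))) (fourPoint t i j p l)
    where
    d : Fin m → Fin m → ℚ
    d = dist t
  fourPoint {suc m} (attach t p w w≥0) (suc i) (suc j) (suc k) zero =
    notAbove-shift w (trans (cong (λ v → d i j + (w + v)) (dist-sym t p k)) (e-awb w (d i j) (d k p)))
                     (trans (cong (λ v → d i k + (w + v)) (dist-sym t p j)) (e-awb w (d i k) (d j p)))
                     (trans (cong (λ v → (w + v) + d j k) (dist-sym t p i)) (e-wab w (d i p) (d j k))) (fourPoint t i j k p)
    where
    d : Fin m → Fin m → ℚ
    d = dist t
  fourPoint {suc m} (attach t p w w≥0) zero zero (suc k) (suc l) =
    notAbove-grow (w + w) (+-mono-≤ w≥0 w≥0) (cong (_+ d k l) (sym (dist-self t p)))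
                  (e-ww w (d p k) (d p l)) (e-ww w (d p l) (d p k)) (fourPoint t p p k l)
    where
    d : Fin m → Fin m → ℚ
    d = dist t
  fourPoint {suc m} (attach t p w w≥0) (suc i) (suc j) zero zero =
    notAbove-grow (w + w) (+-mono-≤ w≥0 w≥0) (cong (d i j +_) (sym (dist-self t p))) pair pair (fourPoint t i j p p)
    where
    d : Fin m → Fin m → ℚ
    d = dist t
    pair : (w + d p i) + (w + d p j) ≡ (d i p + d j p) + (w + w)
    pair = trans (cong₂ (λ a b → (w + a) + (w + b)) (dist-sym t p i) (dist-sym t p j)) (e-ww w (d i p) (d j p))
  fourPoint (attach t p w w≥0) zero (suc j) zero (suc l) = inj₂ (≤-reflexive (+-comm (w + dist t p j) (w + dist t p l)))
  fourPoint (attach t p w w≥0) zero (suc j) (suc k) zero = inj₁ (≤-reflexive (+-comm (w + dist t p j) (w + dist t p k)))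
  fourPoint (attach t p w w≥0) (suc i) zero zero (suc l) = inj₁ ≤-refl
  fourPoint (attach t p w w≥0) (suc i) zero (suc k) zero = inj₂ ≤-refl
  fourPoint (attach t p w w≥0) zero zero zero (suc l) = inj₁ ≤-refl
  fourPoint (attach t p w w≥0) zero zero (suc k) zero = inj₁ (≤-reflexive (+-comm 0ℚ (w + dist t p k)))
  fourPoint (attach t p w w≥0) zero (suc j) zero zero = inj₁ (≤-reflexive (+-comm (w + dist t p j) 0ℚ))
  fourPoint (attach t p w w≥0) (suc i) zero zero zero = inj₁ ≤-refl
  fourPoint (attach t p w w≥0) zero zero zero zero = inj₁ ≤-refl


module Gromov where

  open import Data.Fin as Fin using (Fin; zero; suc; toℕ; fromℕ<)
  import Data.Fin.Properties as Fin
  open import Data.List using (List; _++_; map; filter; length; allFin)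
  open import Data.List.Properties using (length-filter; length-++; length-map; length-tabulate)
  open import Data.List.Membership.Propositional using (_∈_)
  open import Data.List.Membership.Propositional.Properties using (∈-filter⁺; ∈-filter⁻; ∈-allFin; ∈-++⁺ˡ; ∈-++⁺ʳ; ∈-map⁺)
  open import Data.List.Relation.Unary.All as All using (All)
  open import Data.Nat as ℕ using (ℕ; zero; suc)
  import Data.Nat.Properties as ℕ
  open import Data.Product using (_×_; _,_; proj₁; proj₂)
  open import Data.Rational using (ℚ; 0ℚ; _+_; -_; _-_; _≤_; _<_; _⊓_; _<?_)
  open import Data.Rational.Properties
  open import Data.Rational.Solver using (module +-*-Solver)
  open import Data.Sum using (_⊎_; inj₁; inj₂; [_,_]′)
  open import Relation.Binary.Bundles using (DecTotalOrder)
  open import Relation.Binary.Definitions using (tri<; tri≈; tri>)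
  open import Relation.Binary.PropositionalEquality
  open import Relation.Nullary using (yes; no)
  open FourPoint using (NotAbove)
  open Enumeration using (length-filter-<)
  open import Data.List.Extrema (DecTotalOrder.totalOrder ≤-decTotalOrder) using (argmax; argmax-sel; f[xs]≤f[argmax])

  -- Slot inj₁ i stands for the Gromov product of i with itself, inj₂ j for that of j with its parent.
  Slot : ℕ → Set
  Slot n = Fin n ⊎ Fin n

  -- A shape assigns to each leaf j a parent and the ranks of its two slots inj₁ j and inj₂ j.
  Shape : ℕ → Set
  Shape n = Fin n → Fin n × Fin (suc (n ℕ.+ n)) × Fin (suc (n ℕ.+ n))

  module _ {n} (s : Shape n) where

    parent : Fin n → Fin n
    parent j = proj₁ (s j)

    rank : Slot n → ℕ
    rank (inj₁ i) = toℕ (proj₁ (proj₂ (s i)))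
    rank (inj₂ j) = toℕ (proj₂ (proj₂ (s j)))

    lower : Slot n → Slot n → Slot n
    lower u v with rank u ℕ.≤? rank v
    ... | yes _ = u
    ... | no _ = v

    -- The slot holding the Gromov product of i and j, found by walking up the parents of the larger index;
    -- the first argument is a recursion bound exceeding both indices.
    pick : ℕ → Fin n → Fin n → Slot n
    pick zero i j = inj₁ i
    pick (suc b) i j with Fin.<-cmp i j
    ... | tri< _ _ _ = lower (pick b i (parent j)) (inj₂ j)
    ... | tri≈ _ _ _ = inj₁ i
    ... | tri> _ _ _ = lower (pick b j (parent i)) (inj₂ i)

  module GromovProduct {m} (D : Fin (suc m) → Fin (suc m) → ℚ)
    (D-sym : ∀ x y → D x y ≡ D y x) (D-self : ∀ x → D x x ≡ 0ℚ)
    (D-fourPoint : ∀ x y z u → NotAbove (D x y + D z u) (D x z + D y u) (D x u + D y z)) where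

    open +-*-Solver

    height : Fin (suc m) → ℚ
    height = D zero

    -- Twice the Gromov product of i and j, seen from the leaf zero.
    gromov : Fin (suc m) → Fin (suc m) → ℚ
    gromov i j = height i + height j - D i j

    gromov-sym : ∀ i j → gromov i j ≡ gromov j i
    gromov-sym i j = cong₂ _-_ (+-comm (height i) (height j)) (D-sym i j)

    gromov-self : ∀ i → gromov i i ≡ height i + height i
    gromov-self i = trans (cong (λ d → height i + height i - d) (D-self i))
                          (solve 1 (λ h → h :- con 0ℚ := h) refl (height i + height i))

    private
      exchange : ∀ {a b c d} → a + b ≤ c + d → b - d ≤ c - a
      exchange {a} {b} {c} {d} a+b≤c+d = subst₂ _≤_
        (solve 4 (λ a b c d → (a :+ b) :+ (:- a :- d) := b :- d) refl a b c d)
        (solve 4 (λ a b c d → (c :+ d) :+ (:- a :- d) := c :- a) refl a b c d)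
        (+-monoˡ-≤ (- a - d) a+b≤c+d)

      gromov-splitˡ : ∀ i j → gromov i j ≡ height i + (height j - D i j)
      gromov-splitˡ i j = solve 3 (λ a b d → a :+ b :- d := a :+ (b :- d)) refl (height i) (height j) (D i j)

      gromov-splitʳ : ∀ i j → gromov i j ≡ height j + (height i - D i j)
      gromov-splitʳ i j = solve 3 (λ a b d → a :+ b :- d := b :+ (a :- d)) refl (height i) (height j) (D i j)

    gromov-ultrametric : ∀ x y z → gromov x z ⊓ gromov z y ≤ gromov x y
    gromov-ultrametric x y z with D-fourPoint x y zero z
    ... | inj₁ le = ≤-trans (p⊓q≤q (gromov x z) (gromov z y))
      (subst₂ _≤_ (sym (gromov-splitʳ z y)) (sym (gromov-splitʳ x y))
        (+-monoʳ-≤ (height y) (exchange {D x y} {height z} {height x} {D z y}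
          (subst₂ (λ u v → D x y + height z ≤ u + v) (D-sym x zero) (D-sym y z) le))))
    ... | inj₂ le = ≤-trans (p⊓q≤p (gromov x z) (gromov z y))
      (subst₂ _≤_ (sym (gromov-splitˡ x z)) (sym (gromov-splitˡ x y))
        (+-monoʳ-≤ (height x) (exchange {D x y} {height z} {height y} {D x z}
          (subst (D x y + height z ≤_) (trans (cong (D x z +_) (D-sym y zero)) (+-comm (D x z) (height y))) le))))

    gromov-via : ∀ i j a → gromov i j ≤ gromov a j → gromov i j ≡ gromov i a ⊓ gromov a j
    gromov-via i j a ij≤aj = ≤-antisym (⊓-glb ij≤ia ij≤aj) (gromov-ultrametric i j a)
      where
      ij≤ia : gromov i j ≤ gromov i a
      ij≤ia = begin
        gromov i j                  ≡⟨ sym (p≤q⇒p⊓q≡p ij≤aj) ⟩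
        gromov i j ⊓ gromov a j     ≡⟨ cong (gromov i j ⊓_) (gromov-sym a j) ⟩
        gromov i j ⊓ gromov j a     ≤⟨ gromov-ultrametric i a j ⟩
        gromov i a                  ∎
        where open ≤-Reasoning

    slotValue : (Fin (suc m) → Fin (suc m)) → Slot (suc m) → ℚ
    slotValue a (inj₁ i) = height i + height i
    slotValue a (inj₂ j) = gromov (a j) j

    record Describes (s : Shape (suc m)) : Set where
      field
        parent-< : ∀ j → 0 ℕ.< toℕ j → parent s j Fin.< j
        parent-max : ∀ {i j} → i Fin.< j → gromov i j ≤ gromov (parent s j) j
        rank-mono : ∀ u v → rank s u ℕ.≤ rank s v → slotValue (parent s) u ≤ slotValue (parent s) v

    module _ {s : Shape (suc m)} (describes : Describes s) where
      open Describes describes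

      lower-value : ∀ u v → slotValue (parent s) (lower s u v) ≡ slotValue (parent s) u ⊓ slotValue (parent s) v
      lower-value u v with rank s u ℕ.≤? rank s v
      ... | yes u≤v = sym (p≤q⇒p⊓q≡p (rank-mono u v u≤v))
      ... | no u≰v = sym (p≥q⇒p⊓q≡q (rank-mono v u (ℕ.≰⇒≥ u≰v)))

      pick-value : ∀ b i j → toℕ i ℕ.< b → toℕ j ℕ.< b → slotValue (parent s) (pick s b i j) ≡ gromov i j
      pick-value (suc b) i j i<b j<b with Fin.<-cmp i j
      ... | tri≈ _ refl _ = sym (gromov-self i)
      ... | tri< i<j _ _ = trans (lower-value (pick s b i (parent s j)) (inj₂ j))
          (trans (cong (_⊓ gromov (parent s j) j)
                       (pick-value b i (parent s j) (ℕ.<-≤-trans i<j (ℕ.s≤s⁻¹ j<b))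
                                                    (ℕ.<-≤-trans (parent-< j (ℕ.≤-<-trans ℕ.z≤n i<j)) (ℕ.s≤s⁻¹ j<b))))
                 (sym (gromov-via i j (parent s j) (parent-max i<j))))
      ... | tri> _ _ j<i = trans (lower-value (pick s b j (parent s i)) (inj₂ i))
          (trans (cong (_⊓ gromov (parent s i) i)
                       (pick-value b j (parent s i) (ℕ.<-≤-trans j<i (ℕ.s≤s⁻¹ i<b))
                                                    (ℕ.<-≤-trans (parent-< i (ℕ.≤-<-trans ℕ.z≤n j<i)) (ℕ.s≤s⁻¹ i<b))))
                 (trans (sym (gromov-via j i (parent s i) (parent-max j<i))) (gromov-sym j i)))

    canonicalParent : Fin (suc m) → Fin (suc m)
    canonicalParent j = argmax (λ i → gromov i j) zero (filter (Fin._<? j) (allFin (suc m)))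

    private
      value : Slot (suc m) → ℚ
      value = slotValue canonicalParent

      slots : List (Slot (suc m))
      slots = map inj₁ (allFin (suc m)) ++ map inj₂ (allFin (suc m))

      ∈-slots : ∀ v → v ∈ slots
      ∈-slots (inj₁ i) = ∈-++⁺ˡ (∈-map⁺ inj₁ (∈-allFin i))
      ∈-slots (inj₂ j) = ∈-++⁺ʳ (map inj₁ (allFin (suc m))) (∈-map⁺ inj₂ (∈-allFin j))

      length-slots : length slots ≡ suc m ℕ.+ suc m
      length-slots = trans (length-++ (map inj₁ (allFin (suc m))))
        (cong₂ ℕ._+_ (trans (length-map inj₁ (allFin (suc m))) (length-tabulate (λ i → i)))
                     (trans (length-map inj₂ (allFin (suc m))) (length-tabulate (λ i → i))))

    canonicalRank : Slot (suc m) → ℕ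
    canonicalRank v = length (filter (λ u → value u <? value v) slots)

    canonicalRank-bounded : ∀ v → canonicalRank v ℕ.< suc (suc m ℕ.+ suc m)
    canonicalRank-bounded v =
      ℕ.s≤s (ℕ.≤-trans (length-filter (λ u → value u <? value v) slots) (ℕ.≤-reflexive length-slots))

    canonicalRank-mono : ∀ u v → canonicalRank u ℕ.≤ canonicalRank v → value u ≤ value v
    canonicalRank-mono u v ru≤rv = ≮⇒≥ λ v<u →
      ℕ.<⇒≱ (length-filter-< (λ w → value w <? value v) (λ w → value w <? value u)
                              (λ w<v → <-trans w<v v<u) (∈-slots v) (<-irrefl refl) v<u) ru≤rv

    canonical : Shape (suc m)
    canonical j = canonicalParent j , fromℕ< (canonicalRank-bounded (inj₁ j)) , fromℕ< (canonicalRank-bounded (inj₂ j))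

    describes : ∀ s → (∀ j → s j ≡ canonical j) → Describes s
    describes s s≗canonical = record
      { parent-< = λ j 0<j → subst (Fin._< j) (sym (parent≡ j)) (canonicalParent-< j 0<j)
      ; parent-max = λ {i} {j} i<j → subst (λ a → gromov i j ≤ gromov a j) (sym (parent≡ j)) (canonicalParent-max i<j)
      ; rank-mono = λ u v r≤ → subst₂ _≤_ (sym (value≡ u)) (sym (value≡ v))
                                  (canonicalRank-mono u v (subst₂ ℕ._≤_ (rank≡ u) (rank≡ v) r≤))
      }
      where
      parent≡ : ∀ j → parent s j ≡ canonicalParent j
      parent≡ j = cong proj₁ (s≗canonical j)
      rank≡ : ∀ v → rank s v ≡ canonicalRank v
      rank≡ (inj₁ i) = trans (cong (λ x → toℕ (proj₁ (proj₂ x))) (s≗canonical i)) (Fin.toℕ-fromℕ< _)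
      rank≡ (inj₂ j) = trans (cong (λ x → toℕ (proj₂ (proj₂ x))) (s≗canonical j)) (Fin.toℕ-fromℕ< _)
      value≡ : ∀ v → slotValue (parent s) v ≡ value v
      value≡ (inj₁ i) = refl
      value≡ (inj₂ j) = cong (λ a → gromov a j) (parent≡ j)
      canonicalParent-< : ∀ j → 0 ℕ.< toℕ j → canonicalParent j Fin.< j
      canonicalParent-< j 0<j = [ (λ ≡zero → subst (Fin._< j) (sym ≡zero) 0<j)
                                , (λ ∈candidates → proj₂ (∈-filter⁻ (Fin._<? j) ∈candidates)) ]′
                                (argmax-sel (λ i → gromov i j) zero (filter (Fin._<? j) (allFin (suc m))))
      canonicalParent-max : ∀ {i j} → i Fin.< j → gromov i j ≤ gromov (canonicalParent j) j
      canonicalParent-max {i} {j} i<j =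
        All.lookup (f[xs]≤f[argmax] {f = λ i → gromov i j} zero (filter (Fin._<? j) (allFin (suc m))))
                   (∈-filter⁺ (Fin._<? j) (∈-allFin i) i<j)


module Encoding where

  open import Data.Bool using (Bool; true)
  open import Data.Bool.Properties using (¬-not)
  open import Data.Fin as Fin using (Fin; zero; suc; _↑ˡ_; _↑ʳ_)
  import Data.Fin.Properties as Fin
  open import Data.List using (List; []; _∷_; map; length; allFin; concatMap; cartesianProduct)
  open import Data.List.Properties using (length-map; length-tabulate)
  open import Data.List.Membership.Propositional using (_∈_; find; lose)
  open import Data.List.Membership.Propositional.Properties using (∈-allFin; ∈-cartesianProduct⁺; ∈-concatMap⁺)
  open import Data.List.Relation.Unary.All as All using (All; []; _∷_)
  import Data.List.Relation.Unary.All.Properties as All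
  open import Data.List.Relation.Unary.Any as Any using (Any; here; there)
  open import Data.List.Relation.Unary.Any.Properties using (map⁺; concatMap⁺)
  open import Data.Nat as ℕ using (ℕ)
  import Data.Nat.Properties as ℕ
  open import Data.Product using (Σ; _×_; _,_; proj₁; proj₂)
  open import Data.Rational using (ℚ; 0ℚ; _+_; _-_; _<_; _≤_; _<?_)
  open import Data.Rational.Properties
  open import Data.Rational.Solver using (module +-*-Solver)
  open import Data.Sum using (inj₁; inj₂)
  import Data.Vec.Functional as Vector
  open import Data.Vec.Functional.Properties using (lookup-++ˡ; lookup-++ʳ)
  open import Function.Bundles using (_⇔_; mk⇔; Equivalence)
  open import Relation.Binary.PropositionalEquality
  open import Relation.Nullary using (¬_; ¬?; Dec; yes; no; does; _×-dec_)
  open import Relation.Nullary.Decidable using (dec-false; does-⇔)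
  open import Defs using (Graph; adj; irrefl; WTree; dist; SameGraph)
  open Signs
  open AffineForms
  open Arrangements
  open FourPoint
  open Gromov
  open Enumeration

  bool-from-⇔ : ∀ {b : Bool} {Q : Set} (Q? : Dec Q) → (b ≡ true ⇔ Q) → b ≡ does Q?
  bool-from-⇔ (yes q) b⇔Q = Equivalence.from b⇔Q q
  bool-from-⇔ (no ¬q) b⇔Q = ¬-not (λ b≡true → ¬q (Equivalence.to b⇔Q b≡true))

  module Code (m : ℕ) where

    k : ℕ
    k = ℕ.suc m

    -- Coordinates: the two thresholds, the heights of the leaves, and the Gromov products of the leaves
    -- with their parents.
    K : ℕ
    K = 2 ℕ.+ (k ℕ.+ k)

    lowerVar upperVar : Fin K
    lowerVar = zero
    upperVar = suc zero

    heightVar slotVar : Fin k → Fin K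
    heightVar i = suc (suc (i ↑ˡ k))
    slotVar j = suc (suc (k ↑ʳ j))

    slotForm : Slot k → AffineForm K
    slotForm (inj₁ i) = unit (heightVar i) ⊕ unit (heightVar i)
    slotForm (inj₂ j) = unit (slotVar j)

    distanceForm lowerForm upperForm : Shape k → Fin k → Fin k → AffineForm K
    distanceForm s i j = unit (heightVar i) ⊕ unit (heightVar j) ⊖ slotForm (pick s k i j)
    lowerForm s i j = distanceForm s i j ⊖ unit lowerVar
    upperForm s i j = unit upperVar ⊖ distanceForm s i j

    formsAt : Shape k → Fin k × Fin k → List (AffineForm K)
    formsAt s (i , j) = lowerForm s i j ∷ upperForm s i j ∷ []

    forms : Shape k → List (AffineForm K)
    forms s = concatMap (formsAt s) (pairs k)

    length-forms : ∀ s → length (forms s) ℕ.≤ k ℕ.* k ℕ.* 2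
    length-forms s = subst (λ n → length (forms s) ℕ.≤ n ℕ.* 2) (length-pairs k)
                           (length-concatMap-≤ (formsAt s) (λ _ → ℕ.≤-refl) (pairs k))

    lowerForm∈ : ∀ s i j → lowerForm s i j ∈ forms s
    lowerForm∈ s i j = ∈-concatMap⁺ (formsAt s) (lose (∈-pairs i j) (here refl))

    upperForm∈ : ∀ s i j → upperForm s i j ∈ forms s
    upperForm∈ s i j = ∈-concatMap⁺ (formsAt s) (lose (∈-pairs i j) (there (here refl)))

    Window : Shape k → Point K → Fin k → Fin k → Set
    Window s x i j = 0ℚ < eval (lowerForm s i j) x × 0ℚ < eval (upperForm s i j) x

    Edge : Shape k → Point K → Fin k → Fin k → Set
    Edge s x u v = u ≢ v × Window s x u v × Window s x v u

    edge? : ∀ s x u v → Dec (Edge s x u v)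
    edge? s x u v = ¬? (u Fin.≟ v) ×-dec ((0ℚ <? _ ×-dec 0ℚ <? _) ×-dec (0ℚ <? _ ×-dec 0ℚ <? _))

    decode : Shape k → Point K → Graph k
    decode s x = record
      { adj = λ u v → does (edge? s x u v)
      ; sym = λ u v → does-⇔ (mk⇔ swap swap) (edge? s x u v) (edge? s x v u)
      ; irrefl = λ u → dec-false (edge? s x u u) (λ (u≢u , _) → u≢u refl)
      }
      where
      swap : ∀ {u v} → Edge s x u v → Edge s x v u
      swap (u≢v , uv , vu) = (λ v≡u → u≢v (sym v≡u)) , vu , uv

    R : ℕ
    R = ℕ.suc (k ℕ.+ k)

    Triple : Set
    Triple = Fin k × Fin R × Fin R

    opaque
      triples : List Triple
      triples = cartesianProduct (allFin k) (cartesianProduct (allFin R) (allFin R))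

      ∈-triples : ∀ t → t ∈ triples
      ∈-triples (a , r₁ , r₂) = ∈-cartesianProduct⁺ (∈-allFin a) (∈-cartesianProduct⁺ (∈-allFin r₁) (∈-allFin r₂))

      length-triples : length triples ≡ k ℕ.* (R ℕ.* R)
      length-triples = trans (length-cartesianProduct (allFin k) (cartesianProduct (allFin R) (allFin R)))
        (cong₂ ℕ._*_ (length-tabulate {n = k} (λ i → i))
                     (trans (length-cartesianProduct (allFin R) (allFin R))
                            (cong₂ ℕ._*_ (length-tabulate {n = R} (λ i → i)) (length-tabulate {n = R} (λ i → i)))))

    cells : Shape k → List (Point K)
    cells s = proj₁ (representatives K (forms s))

    candidates : List (Graph k)
    candidates = concatMap (λ s → map (decode s) (cells s)) (functions triples k)

    length-candidates : length candidates ℕ.≤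
      (k ℕ.* (R ℕ.* R)) ℕ.^ k ℕ.* (1 ℕ.+ 2 ℕ.* (k ℕ.* k ℕ.* 2)) ℕ.^ K
    length-candidates = ℕ.≤-trans
      (length-concatMap-≤ (λ s → map (decode s) (cells s)) cells-bound (functions triples k))
      (ℕ.*-monoˡ-≤ _ (subst (λ n → length (functions triples k) ℕ.≤ n ℕ.^ k) length-triples
                                 (length-functions triples k)))
      where
      cells-bound : ∀ s → length (map (decode s) (cells s)) ℕ.≤ (1 ℕ.+ 2 ℕ.* (k ℕ.* k ℕ.* 2)) ℕ.^ K
      cells-bound s = ℕ.≤-trans (ℕ.≤-reflexive (length-map (decode s) (cells s)))
        (ℕ.≤-trans (proj₁ (proj₂ (representatives K (forms s))))
                   (ℕ.^-monoˡ-≤ K (ℕ.+-monoʳ-≤ 1 (ℕ.*-monoʳ-≤ 2 (length-forms s)))))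

    module Completeness (G : Graph k) {n} (T : WTree n) (L U : ℚ) (ζ : Fin k → Fin n)
      (edge : ∀ u v → ¬ u ≡ v → (adj G u v ≡ true) ⇔ (L ≤ dist T (ζ u) (ζ v) × dist T (ζ u) (ζ v) ≤ U)) where

      open +-*-Solver

      D : Fin k → Fin k → ℚ
      D i j = dist T (ζ i) (ζ j)

      open GromovProduct D (λ i j → dist-sym T (ζ i) (ζ j)) (λ i → dist-self T (ζ i))
                           (λ x y z u → fourPoint T (ζ x) (ζ y) (ζ z) (ζ u))

      -- Only the stated properties of s and w matter; keeping them opaque stops the enumerations from unfolding.
      opaque
        s : Shape k
        s = proj₁ (find (functions-complete ∈-triples k canonical))

        s∈shapes : s ∈ functions triples k
        s∈shapes = proj₁ (proj₂ (find (functions-complete ∈-triples k canonical)))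

        s-describes : Describes s
        s-describes = describes s (proj₂ (proj₂ (find (functions-complete ∈-triples k canonical))))

      private
        below-L above-U : Fin k × Fin k → ℚ
        below-L (i , j) = L - D i j
        above-U (i , j) = D i j - U
        lowerGap : Σ ℚ λ ε → 0ℚ < ε × All (λ ij → 0ℚ < below-L ij → ε < below-L ij) (pairs k)
        lowerGap = belowPositives below-L (pairs k)
        upperGap : Σ ℚ λ ε → 0ℚ < ε × All (λ ij → 0ℚ < above-U ij → ε < above-U ij) (pairs k)
        upperGap = belowPositives above-U (pairs k)
        εL εU : ℚ
        εL = proj₁ lowerGap
        εU = proj₁ upperGap

      -- The window [L, U] widened to the open window (L′, U′) with no distance D i j on its ends.
      L′ U′ : ℚ
      L′ = L - εL
      U′ = U + εU

      L′-threshold : ∀ i j → (L ≤ D i j ⇔ L′ < D i j) × D i j ≢ L′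
      L′-threshold i j = lowered-threshold L′<L below
        where
        L′<L : L′ < L
        L′<L = 0<q-p⇒p<q (subst (0ℚ <_) (solve 2 (λ l e → e := l :- (l :- e)) refl L εL) (proj₁ (proj₂ lowerGap)))
        below : D i j < L → D i j < L′
        below d<L = 0<q-p⇒p<q (subst (0ℚ <_) (solve 3 (λ l d e → l :- d :- e := l :- e :- d) refl L (D i j) εL)
          (p<q⇒0<q-p (All.lookup (proj₂ (proj₂ lowerGap)) (∈-pairs i j) (p<q⇒0<q-p d<L))))

      U′-threshold : ∀ i j → (D i j ≤ U ⇔ D i j < U′) × D i j ≢ U′
      U′-threshold i j = raised-threshold U<U′ above
        where
        U<U′ : U < U′
        U<U′ = 0<q-p⇒p<q (subst (0ℚ <_) (solve 2 (λ u e → e := u :+ e :- u) refl U εU) (proj₁ (proj₂ upperGap)))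
        above : U < D i j → U′ < D i j
        above U<d = 0<q-p⇒p<q (subst (0ℚ <_) (solve 3 (λ u d e → d :- u :- e := d :- (u :+ e)) refl U (D i j) εU)
          (p<q⇒0<q-p (All.lookup (proj₂ (proj₂ upperGap)) (∈-pairs i j) (p<q⇒0<q-p U<d))))

      point : Point K
      point = L′ Vector.∷ U′ Vector.∷ (height Vector.++ λ j → gromov (parent s j) j)

      eval-height : ∀ i → eval (unit (heightVar i)) point ≡ height i
      eval-height i = trans (eval-unit (heightVar i) point) (lookup-++ˡ height _ i)

      eval-slot : ∀ v → eval (slotForm v) point ≡ slotValue (parent s) v
      eval-slot (inj₁ i) = trans (eval-⊕ (unit (heightVar i)) (unit (heightVar i)) point)
                                 (cong₂ _+_ (eval-height i) (eval-height i))
      eval-slot (inj₂ j) = trans (eval-unit (slotVar j) point) (lookup-++ʳ height _ j)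

      eval-distance : ∀ i j → eval (distanceForm s i j) point ≡ D i j
      eval-distance i j = begin
        eval (distanceForm s i j) point
          ≡⟨ eval-⊖ (unit (heightVar i) ⊕ unit (heightVar j)) (slotForm (pick s k i j)) point ⟩
        eval (unit (heightVar i) ⊕ unit (heightVar j)) point - eval (slotForm (pick s k i j)) point
          ≡⟨ cong₂ _-_ (trans (eval-⊕ (unit (heightVar i)) (unit (heightVar j)) point)
                              (cong₂ _+_ (eval-height i) (eval-height j)))
                       (trans (eval-slot (pick s k i j)) (pick-value s-describes k i j (Fin.toℕ<n i) (Fin.toℕ<n j))) ⟩
        height i + height j - (height i + height j - D i j)
          ≡⟨ solve 3 (λ a b d → a :+ b :- (a :+ b :- d) := d) refl (height i) (height j) (D i j) ⟩
        D i j ∎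
        where open ≡-Reasoning

      eval-lower : ∀ i j → eval (lowerForm s i j) point ≡ D i j - L′
      eval-lower i j = trans (eval-⊖ (distanceForm s i j) (unit lowerVar) point)
                             (cong₂ _-_ (eval-distance i j) (eval-unit lowerVar point))

      eval-upper : ∀ i j → eval (upperForm s i j) point ≡ U′ - D i j
      eval-upper i j = trans (eval-⊖ (unit upperVar) (distanceForm s i j) point)
                             (cong₂ _-_ (eval-unit upperVar point) (eval-distance i j))

      window : ∀ i j → Window s point i j ⇔ (L ≤ D i j × D i j ≤ U)
      window i j = mk⇔
        (λ (lo , up) → Equivalence.from (proj₁ (L′-threshold i j)) (0<q-p⇒p<q (subst (0ℚ <_) (eval-lower i j) lo)) ,
                       Equivalence.from (proj₁ (U′-threshold i j)) (0<q-p⇒p<q (subst (0ℚ <_) (eval-upper i j) up)))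
        (λ (L≤d , d≤U) → subst (0ℚ <_) (sym (eval-lower i j)) (p<q⇒0<q-p (Equivalence.to (proj₁ (L′-threshold i j)) L≤d)) ,
                         subst (0ℚ <_) (sym (eval-upper i j)) (p<q⇒0<q-p (Equivalence.to (proj₁ (U′-threshold i j)) d≤U)))

      avoids : Avoids (forms s) point
      avoids = All.concat⁺ (All.map⁺ {f = formsAt s} (All.tabulate {xs = pairs k} (λ {(i , j)} _ →
        (λ lower≡0 → proj₂ (L′-threshold i j) (difference≡0 (trans (sym (eval-lower i j)) lower≡0))) ∷
        (λ upper≡0 → proj₂ (U′-threshold i j) (sym (difference≡0 (trans (sym (eval-upper i j)) upper≡0)))) ∷ [])))
        where
        difference≡0 : ∀ {x y} → x - y ≡ 0ℚ → x ≡ y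
        difference≡0 {x} {y} x-y≡0 = trans (solve 2 (λ x y → x := x :- y :+ y) refl x y)
                                           (trans (cong (_+ y) x-y≡0) (+-identityˡ y))

      opaque
        w : Point K
        w = proj₁ (find (proj₂ (proj₂ (representatives K (forms s))) point avoids))

        w∈cells : w ∈ cells s
        w∈cells = proj₁ (proj₂ (find (proj₂ (proj₂ (representatives K (forms s))) point avoids)))

        w≈point : w ≈[ forms s ] point
        w≈point = proj₂ (proj₂ (find (proj₂ (proj₂ (representatives K (forms s))) point avoids)))

      window-w : ∀ i j → Window s w i j ⇔ Window s point i j
      window-w i j = mk⇔
        (λ (lo , up) → Equivalence.to (sameSign-positive (lookup (lowerForm∈ s i j))) lo ,
                       Equivalence.to (sameSign-positive (lookup (upperForm∈ s i j))) up)
        (λ (lo , up) → Equivalence.from (sameSign-positive (lookup (lowerForm∈ s i j))) lo ,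
                       Equivalence.from (sameSign-positive (lookup (upperForm∈ s i j))) up)
        where
        lookup : ∀ {f} → f ∈ forms s → SameSign (eval f w) (eval f point)
        lookup = All.lookup w≈point

      decode-same : SameGraph G (decode s w)
      decode-same u v = cases (u Fin.≟ v)
        where
        InRange : ℚ → Set
        InRange d = L ≤ d × d ≤ U
        cases : Dec (u ≡ v) → adj G u v ≡ does (edge? s w u v)
        cases (yes refl) = trans (irrefl G u) (sym (dec-false (edge? s w u u) (λ (u≢u , _) → u≢u refl)))
        cases (no u≢v) = bool-from-⇔ (edge? s w u v) (mk⇔
          (λ adj≡true → let inRange = Equivalence.to (edge u v u≢v) adj≡true in
             u≢v , Equivalence.from (window-w u v) (Equivalence.from (window u v) inRange)
                 , Equivalence.from (window-w v u)
                     (Equivalence.from (window v u) (subst InRange (dist-sym T (ζ u) (ζ v)) inRange)))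
          (λ (_ , uv , _) → Equivalence.from (edge u v u≢v)
                              (Equivalence.to (window u v) (Equivalence.to (window-w u v) uv))))


      complete : Any (SameGraph G) candidates
      complete = concatMap⁺ (λ s → map (decode s) (cells s)) (lose s∈shapes (map⁺ (lose w∈cells decode-same)))


open import Data.Fin using (zero)
open import Data.Bool using (false)
open import Data.List using ([]; _∷_)
open import Data.List.Relation.Unary.Any using (here)
open import Data.Nat using (ℕ; zero; suc; _+_; _≤_; _^_; _*_; s≤s; z≤n)
open import Data.Nat.Properties using (≤-trans; ≤-reflexive; m≤m+n; *-mono-≤; ^-monoˡ-≤; ^-monoʳ-≤; ^-*-assoc; ^-distribˡ-+-*)
open import Data.Nat.Solver using (module +-*-Solver)
open import Data.Product using (Σ; _×_; _,_)
open import Relation.Binary.PropositionalEquality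
open import Defs using (Graph; irrefl; NumPCG≤)
open Encoding using (module Code)

private
  module Bound (t : ℕ) where
    open +-*-Solver
    open Code (suc t) using (k; R; K)

    ≤-by : ∀ {a b} c → b ≡ a + c → a ≤ b
    ≤-by {a} c b≡a+c = subst (a ≤_) (sym b≡a+c) (m≤m+n a c)

    -- Each identity below exhibits the nonnegative difference as a polynomial in t = k - 2.
    shape-base : k * (R * R) ≤ k ^ 6
    shape-base = ≤-by (t ^ 6 + 12 * t ^ 5 + 60 * t ^ 4 + 156 * t ^ 3 + 212 * t ^ 2 + 127 * t + 14)
      (solve 1 (λ t → let κ = con 2 :+ t ; ρ = con 1 :+ (κ :+ κ) in
                      κ :^ 6 := κ :* (ρ :* ρ)
                      :+ (t :^ 6 :+ con 12 :* t :^ 5 :+ con 60 :* t :^ 4 :+ con 156 :* t :^ 3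
                          :+ con 212 :* t :^ 2 :+ con 127 :* t :+ con 14))
             refl t)

    cell-base : 1 + 2 * (k * k * 2) ≤ k ^ 5
    cell-base = ≤-by (t ^ 5 + 10 * t ^ 4 + 40 * t ^ 3 + 76 * t ^ 2 + 64 * t + 15)
      (solve 1 (λ t → let κ = con 2 :+ t in
                      κ :^ 5 := con 1 :+ con 2 :* (κ :* κ :* con 2)
                      :+ (t :^ 5 :+ con 10 :* t :^ 4 :+ con 40 :* t :^ 3 :+ con 76 :* t :^ 2 :+ con 64 :* t :+ con 15))
             refl t)

    exponent : 6 * k + 5 * K ≤ 21 * k
    exponent = ≤-by (5 * t) (solve 1 (λ t → let κ = con 2 :+ t in
                                          con 21 :* κ := con 6 :* κ :+ con 5 :* (con 2 :+ (κ :+ κ)) :+ con 5 :* t)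
                                     refl t)

    candidates-bound : (k * (R * R)) ^ k * (1 + 2 * (k * k * 2)) ^ K ≤ k ^ (21 * k)
    candidates-bound = ≤-trans (*-mono-≤ (^-monoˡ-≤ k shape-base) (^-monoˡ-≤ K cell-base))
      (≤-trans (≤-reflexive (trans (cong₂ _*_ (^-*-assoc k 6 k) (^-*-assoc k 5 K))
                                   (sym (^-distribˡ-+-* k (6 * k) (5 * K)))))
               (^-monoʳ-≤ k exponent))

lemma10 : Σ ℕ λ C → (1 ≤ C) × (∀ (n : ℕ) → 1 ≤ n → NumPCG≤ n (n ^ (C * n)))
lemma10 = 21 , s≤s z≤n , count
  where
  count : ∀ n → 1 ≤ n → NumPCG≤ n (n ^ (21 * n))
  count (suc zero) _ = edgeless ∷ [] , s≤s z≤n , λ G _ → here (λ { zero zero → irrefl G zero })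
    where
    edgeless : Graph 1
    edgeless = record { adj = λ _ _ → false ; sym = λ _ _ → refl ; irrefl = λ _ → refl }
  count (suc (suc t)) _ =
    candidates , ≤-trans length-candidates (Bound.candidates-bound t) ,
    λ { G (_ , T , L , U , ζ , _ , _ , _ , _ , _ , edge) → Completeness.complete G T L U ζ edge }
    where open Code (suc t)
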